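{- Let $X$ be a finite set, $d$ a distance on $X$ of negative type, $M_1=(X,\mathcal{I}_1)$, $M_2=(X,\mathcal{I}_2)$ matroids on $X$, $p\in\mathbb{Z}_{\ge2}$, and $A,B\in\mathcal{I}_1\cap\mathcal{I}_2$ with $A\neq\emptyset$. Let $P_1,\dots,P_m\subseteq X$ be nonempty sets and $\lambda_1,\dots,\lambda_m>0$ such that $|P_i\cap A|\le p$, $|P_i\cap B|\le p-1$, $A\,\Delta\,P_i\in\mathcal{I}_1\cap\mathcal{I}_2$ for all $i$, and $\sum_{i=1}^m\lambda_i\chi^{P_i}=\frac{p}{p-1}\chi^{A\setminus B}+\chi^{B\setminus A}$. Then $$\frac{|A|}{2p-1}\sum_{i=1}^m\lambda_i\,d(P_i)\le\frac{p}{p-1}d(A,A)+d(A,B).$$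
   Context: A distance on $X$ is a symmetric $d:X\times X\to\mathbb{R}_{\ge0}$ with $d(a,a)=0$; it is of negative type if its matrix $D$ satisfies $x^TDx\le0$ for all $x\in\mathbb{R}^X$ with $\sum_a x_a=0$. $d(S)=\sum_{\{a,b\}\subseteq S}d(a,b)$ and $d(S,T)=\sum_{a\in S,b\in T}d(a,b)$. $\Delta$ is symmetric difference, $\chi^S$ the characteristic vector of $S$. -}

module Defs where

open import Level using (0ℓ)
open import Data.Nat as ℕ using (ℕ; zero; suc)
open import Data.Bool using (Bool; true; false; if_then_else_)
open import Data.Fin using (Fin; toℕ)
open import Data.Fin.Subset using (Subset; ⊥; ⁅_⁆; _∪_; _─_; _∈_; _∉_; _⊆_; ∣_∣)
open import Data.Vec using (lookup)
open import Data.Product using (Σ; ∃; _×_; _,_)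
open import Data.Sum using (_⊎_)
open import Relation.Binary.PropositionalEquality using (_≡_; _≢_)

-- The real numbers, axiomatised as a Dedekind-complete ordered field
-- (unique up to isomorphism, so any model of this record is ℝ).
-- The multiplicative inverse is a total operation, only constrained on
-- nonzero arguments.

record CompleteOrderedField : Set₁ where
  infixl 6 _+_
  infixl 7 _*_
  infix  4 _≤_
  field
    Carrier : Set
    0# 1#   : Carrier
    _+_ _*_ : Carrier → Carrier → Carrier
    -_      : Carrier → Carrier
    _⁻¹     : Carrier → Carrier
    _≤_     : Carrier → Carrier → Set
    +-assoc      : ∀ x y z → (x + y) + z ≡ x + (y + z)
    +-comm       : ∀ x y → x + y ≡ y + x
    +-identityˡ  : ∀ x → 0# + x ≡ x
    -‿inverseˡ   : ∀ x → (- x) + x ≡ 0#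
    *-assoc      : ∀ x y z → (x * y) * z ≡ x * (y * z)
    *-comm       : ∀ x y → x * y ≡ y * x
    *-identityˡ  : ∀ x → 1# * x ≡ x
    ⁻¹-inverseˡ  : ∀ x → x ≢ 0# → (x ⁻¹) * x ≡ 1#
    distribˡ     : ∀ x y z → x * (y + z) ≡ (x * y) + (x * z)
    0≢1          : 0# ≢ 1#
    ≤-refl       : ∀ x → x ≤ x
    ≤-trans      : ∀ {x y z} → x ≤ y → y ≤ z → x ≤ z
    ≤-antisym    : ∀ {x y} → x ≤ y → y ≤ x → x ≡ y
    ≤-total      : ∀ x y → x ≤ y ⊎ y ≤ x
    +-monoˡ-≤    : ∀ {x y} z → x ≤ y → x + z ≤ y + z
    *-nonneg     : ∀ {x y} → 0# ≤ x → 0# ≤ y → 0# ≤ x * y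
    sup : (S : Carrier → Set) → (∃ λ x → S x) → (∃ λ b → ∀ x → S x → x ≤ b) →
          ∃ λ s → (∀ x → S x → x ≤ s) × (∀ b → (∀ x → S x → x ≤ b) → s ≤ b)

infixl 5 _Δ_
_Δ_ : ∀ {n} → Subset n → Subset n → Subset n
A Δ B = (A ─ B) ∪ (B ─ A)

record Matroid (n : ℕ) : Set₁ where
  field
    Indep        : Subset n → Set
    indep-∅      : Indep ⊥
    indep-⊆      : ∀ {A B} → B ⊆ A → Indep A → Indep B
    indep-augment : ∀ {A B} → Indep A → Indep B → ∣ A ∣ ℕ.< ∣ B ∣ →
                    ∃ λ x → x ∈ B × x ∉ A × Indep (A ∪ ⁅ x ⁆)

module OverReals (R : CompleteOrderedField) where
  open CompleteOrderedField R

  _<_ : Carrier → Carrier → Set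
  x < y = x ≤ y × x ≢ y

  fromℕ : ℕ → Carrier
  fromℕ zero    = 0#
  fromℕ (suc k) = 1# + fromℕ k

  _/_ : Carrier → Carrier → Carrier
  x / y = x * (y ⁻¹)

  Σ[_] : ∀ {k} → (Fin k → Carrier) → Carrier
  Σ[_] {zero}  f = 0#
  Σ[_] {suc k} f = f Fin.zero + Σ[ (λ i → f (Fin.suc i)) ]

  χ : ∀ {n} → Subset n → Fin n → Carrier
  χ S x = if lookup S x then 1# else 0#

  record IsDistance {n} (d : Fin n → Fin n → Carrier) : Set where
    field
      nonneg : ∀ a b → 0# ≤ d a b
      sym    : ∀ a b → d a b ≡ d b a
      refl0  : ∀ a → d a a ≡ 0#

  NegativeType : ∀ {n} → (Fin n → Fin n → Carrier) → Set
  NegativeType d = ∀ x → Σ[ x ] ≡ 0# →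
    Σ[ (λ a → Σ[ (λ b → x a * d a b * x b) ]) ] ≤ 0#

  -- d(S) = Σ_{{a,b} ⊆ S} d(a,b) (unordered pairs of distinct elements)
  dSet : ∀ {n} → (Fin n → Fin n → Carrier) → Subset n → Carrier
  dSet d S = Σ[ (λ a → Σ[ (λ b →
    if toℕ a ℕ.<ᵇ toℕ b then χ S a * χ S b * d a b else 0#) ]) ]

  dPair : ∀ {n} → (Fin n → Fin n → Carrier) → Subset n → Subset n → Carrier
  dPair d S T = Σ[ (λ a → Σ[ (λ b → χ S a * χ T b * d a b) ]) ]

module Submission where

open import Defs
open import Data.Nat as N using (ℕ)
open import Data.Fin using (Fin)
open import Data.Fin.Subset using (Subset)
open import Data.Fin.Subset as S using ()
open import Data.Product using (_×_)
open import Relation.Binary.PropositionalEquality using (_≡_)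
open import Relation.Binary.PropositionalEquality using (_≢_)


-- A negative-type distance satisfies |A| d(P) ≤ |P| d(P,A): apply negative type to
-- |A| χ^P − |P| χ^A, whose entries sum to zero, and use d(P,P) = 2 d(P).
-- Positivity of the λᵢ forces Pᵢ ⊆ A ∪ B, so |Pᵢ| ≤ |Pᵢ ∩ A| + |Pᵢ ∩ B| ≤ 2p − 1 and
-- therefore (|A| / (2p − 1)) d(Pᵢ) ≤ d(Pᵢ, A). Since d(·, A) is linear, summing with the
-- weights λᵢ gives d(Σ λᵢ χ^{Pᵢ}, A) = d((p/(p−1)) χ^{A∖B} + χ^{B∖A}, A), which is at most
-- (p/(p−1)) d(A,A) + d(B,A) because d ≥ 0.

open import Level using (0ℓ)
open import Data.Nat using (zero; suc)
import Data.Nat.Properties as NP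
open import Data.Fin using (toℕ)
import Data.Fin as Fin
import Data.Fin.Properties as FP
open import Data.Fin.Subset using (⊥; _∈_; _∉_; _⊆_; _∪_; _∩_; _─_; ∣_∣)
open import Data.Fin.Subset.Properties using (_∈?_; p⊆p∪q; q⊆p∪q; p─q⊆p; x∈p∪q⁻; x∈p∪q⁺; x∈p∩q⁺; x∈p⇒∣p-x∣<∣p∣; nonempty?; Empty-unique)
open import Data.Bool using (Bool; true; false; _∨_; if_then_else_)
open import Data.Vec using ([]; _∷_; lookup)
open import Data.Vec.Properties using ([]=⇒lookup; lookup⇒[]=; lookup-zipWith)
open import Data.Product using (_,_; proj₁; proj₂)
open import Data.Sum using (inj₁; inj₂; [_,_]′)
open import Data.Empty using (⊥-elim)
open import Function using (_∘_)
open import Relation.Nullary using (yes; no)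
open import Relation.Nullary.Reflects using (ofʸ; ofⁿ)
open import Relation.Binary.PropositionalEquality
  using (refl; sym; trans; cong; cong₂; subst; subst₂; isEquivalence; module ≡-Reasoning)
open import Relation.Binary.Bundles using (Poset)
open import Relation.Binary.Structures using (IsPartialOrder)
open import Algebra.Bundles using (CommutativeRing)
open import Algebra.Structures using (IsCommutativeRing)
import Relation.Binary.Reasoning.PartialOrder

module OrderedFieldProperties (R : CompleteOrderedField) where
  open CompleteOrderedField R
  open OverReals R

  +-identityʳ : ∀ x → x + 0# ≡ x
  +-identityʳ x = trans (+-comm x 0#) (+-identityˡ x)

  *-identityʳ : ∀ x → x * 1# ≡ x
  *-identityʳ x = trans (*-comm x 1#) (*-identityˡ x)

  -‿inverseʳ : ∀ x → x + - x ≡ 0#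
  -‿inverseʳ x = trans (+-comm x (- x)) (-‿inverseˡ x)

  distribʳ : ∀ x y z → (y + z) * x ≡ y * x + z * x
  distribʳ x y z = trans (*-comm (y + z) x)
    (trans (distribˡ x y z) (cong₂ _+_ (*-comm x y) (*-comm x z)))

  isCommutativeRing : IsCommutativeRing _≡_ _+_ _*_ -_ 0# 1#
  isCommutativeRing = record
    { isRing = record
      { +-isAbelianGroup = record
        { isGroup = record
          { isMonoid = record
            { isSemigroup = record
              { isMagma = record { isEquivalence = isEquivalence ; ∙-cong = cong₂ _+_ }
              ; assoc = +-assoc }
            ; identity = +-identityˡ , +-identityʳ }
          ; inverse = -‿inverseˡ , -‿inverseʳ
          ; ⁻¹-cong = cong -_ }
        ; comm = +-comm }
      ; *-cong = cong₂ _*_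
      ; *-assoc = *-assoc
      ; *-identity = *-identityˡ , *-identityʳ
      ; distrib = distribˡ , distribʳ }
    ; *-comm = *-comm }

  commutativeRing : CommutativeRing 0ℓ 0ℓ
  commutativeRing = record { isCommutativeRing = isCommutativeRing }

  open CommutativeRing commutativeRing public using (zeroˡ; zeroʳ; commutativeSemiring)
  open import Algebra.Properties.Ring (CommutativeRing.ring commutativeRing) public
    using (-‿distribˡ-*; x[y-z]≈xy-xz)
  open import Algebra.Properties.AbelianGroup (CommutativeRing.+-abelianGroup commutativeRing) public
    using (⁻¹-∙-comm; ε⁻¹≈ε; ⁻¹-involutive; //-rightDividesˡ; x≈y⇒x∙y⁻¹≈ε)
  open import Algebra.Solver.Ring.NaturalCoefficients.Default commutativeSemiring public
    using (solve; _:+_; _:*_; _:=_)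

  ≤-reflexive : ∀ {x y} → x ≡ y → x ≤ y
  ≤-reflexive {x} refl = ≤-refl x

  isPartialOrder : IsPartialOrder _≡_ _≤_
  isPartialOrder = record
    { isPreorder = record
      { isEquivalence = isEquivalence
      ; reflexive = ≤-reflexive
      ; trans = ≤-trans }
    ; antisym = ≤-antisym }

  poset : Poset 0ℓ 0ℓ 0ℓ
  poset = record { isPartialOrder = isPartialOrder }

  module ≤-Reasoning = Relation.Binary.Reasoning.PartialOrder poset

  +-monoʳ-≤ : ∀ {x y} z → x ≤ y → z + x ≤ z + y
  +-monoʳ-≤ {x} {y} z x≤y = subst₂ _≤_ (+-comm x z) (+-comm y z) (+-monoˡ-≤ z x≤y)

  +-mono-≤ : ∀ {x y u v} → x ≤ y → u ≤ v → x + u ≤ y + v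
  +-mono-≤ {y = y} {u} x≤y u≤v = ≤-trans (+-monoˡ-≤ u x≤y) (+-monoʳ-≤ y u≤v)

  x≤x+y : ∀ {x y} → 0# ≤ y → x ≤ x + y
  x≤x+y {x} 0≤y = subst (_≤ x + _) (+-identityʳ x) (+-monoʳ-≤ x 0≤y)

  x≤0⇒x+y≤y : ∀ {x y} → x ≤ 0# → x + y ≤ y
  x≤0⇒x+y≤y {x} {y} x≤0 = subst (x + y ≤_) (+-identityˡ y) (+-monoˡ-≤ y x≤0)

  x≤y⇒0≤y-x : ∀ {x y} → x ≤ y → 0# ≤ y + - x
  x≤y⇒0≤y-x {x} x≤y = subst (_≤ _) (-‿inverseʳ x) (+-monoˡ-≤ (- x) x≤y)

  0≤y-x⇒x≤y : ∀ {x y} → 0# ≤ y + - x → x ≤ y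
  0≤y-x⇒x≤y {x} {y} 0≤y-x = subst₂ _≤_ (+-identityˡ x) (//-rightDividesˡ x y) (+-monoˡ-≤ x 0≤y-x)

  *-monoˡ-≤ : ∀ {c x y} → 0# ≤ c → x ≤ y → c * x ≤ c * y
  *-monoˡ-≤ {c} {x} {y} 0≤c x≤y =
    0≤y-x⇒x≤y (subst (0# ≤_) (x[y-z]≈xy-xz c y x) (*-nonneg 0≤c (x≤y⇒0≤y-x x≤y)))

  *-monoʳ-≤ : ∀ {c x y} → 0# ≤ c → x ≤ y → x * c ≤ y * c
  *-monoʳ-≤ {c} {x} {y} 0≤c x≤y = subst₂ _≤_ (*-comm c x) (*-comm c y) (*-monoˡ-≤ 0≤c x≤y)

  -- 1 is a square: 1 = (-1) * (-1).
  0≤1 : 0# ≤ 1#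
  0≤1 with ≤-total 0# 1#
  ... | inj₁ 0≤1 = 0≤1
  ... | inj₂ 1≤0 = subst (0# ≤_) -1*-1≡1 (*-nonneg 0≤-1 0≤-1)
    where
      0≤-1 : 0# ≤ - 1#
      0≤-1 = subst₂ _≤_ (-‿inverseʳ 1#) (+-identityˡ (- 1#)) (+-monoˡ-≤ (- 1#) 1≤0)
      -1*-1≡1 : - 1# * - 1# ≡ 1#
      -1*-1≡1 = trans (sym (-‿distribˡ-* 1# (- 1#)))
        (trans (cong -_ (*-identityˡ (- 1#))) (⁻¹-involutive 1#))

  0<1 : 0# < 1#
  0<1 = 0≤1 , 0≢1

  +-pos-nonneg : ∀ {x y} → 0# < x → 0# ≤ y → 0# < (x + y)
  +-pos-nonneg {x} {y} (0≤x , 0≢x) 0≤y = ≤-trans 0≤x x≤x+y′ , λ 0≡x+y →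
    0≢x (≤-antisym 0≤x (subst (x ≤_) (sym 0≡x+y) x≤x+y′))
    where
      x≤x+y′ : x ≤ x + y
      x≤x+y′ = x≤x+y 0≤y

  ⁻¹-inverseʳ : ∀ {x} → 0# < x → x * x ⁻¹ ≡ 1#
  ⁻¹-inverseʳ {x} (_ , 0≢x) = trans (*-comm x (x ⁻¹)) (⁻¹-inverseˡ x (0≢x ∘ sym))

  ⁻¹-cancelˡ : ∀ {c} → 0# < c → ∀ x → c ⁻¹ * (c * x) ≡ x
  ⁻¹-cancelˡ {c} 0<c x = trans (sym (*-assoc (c ⁻¹) c x))
    (trans (cong (_* x) (trans (*-comm (c ⁻¹) c) (⁻¹-inverseʳ 0<c))) (*-identityˡ x))

  ⁻¹-nonneg : ∀ {x} → 0# < x → 0# ≤ x ⁻¹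
  ⁻¹-nonneg {x} 0<x with ≤-total 0# (x ⁻¹)
  ... | inj₁ 0≤x⁻¹ = 0≤x⁻¹
  ... | inj₂ x⁻¹≤0 = ⊥-elim (0≢1 (≤-antisym 0≤1 1≤0))
    where
      1≤0 : 1# ≤ 0#
      1≤0 = subst₂ _≤_ (⁻¹-inverseʳ 0<x) (zeroʳ x) (*-monoˡ-≤ (proj₁ 0<x) x⁻¹≤0)

  /-nonneg : ∀ {x y} → 0# ≤ x → 0# < y → 0# ≤ x / y
  /-nonneg 0≤x 0<y = *-nonneg 0≤x (⁻¹-nonneg 0<y)

  *-cancelˡ-≤ : ∀ {c x y} → 0# < c → c * x ≤ c * y → x ≤ y
  *-cancelˡ-≤ {c} {x} {y} 0<c cx≤cy =
    subst₂ _≤_ (⁻¹-cancelˡ 0<c x) (⁻¹-cancelˡ 0<c y) (*-monoˡ-≤ (⁻¹-nonneg 0<c) cx≤cy)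

  *-≤-⇒-/-≤ : ∀ {a c x y} → 0# < c → a * x ≤ c * y → (a / c) * x ≤ y
  *-≤-⇒-/-≤ {a} {c} {x} {y} 0<c ax≤cy = begin
    (a / c) * x       ≡⟨ solve 3 (λ a c⁻¹ x → (a :* c⁻¹) :* x := c⁻¹ :* (a :* x)) refl a (c ⁻¹) x ⟩
    c ⁻¹ * (a * x)    ≤⟨ *-monoˡ-≤ (⁻¹-nonneg 0<c) ax≤cy ⟩
    c ⁻¹ * (c * y)    ≡⟨ ⁻¹-cancelˡ 0<c y ⟩
    y                 ∎
    where open ≤-Reasoning

  fromℕ-+ : ∀ m n → fromℕ (m N.+ n) ≡ fromℕ m + fromℕ n
  fromℕ-+ zero    n = sym (+-identityˡ (fromℕ n))
  fromℕ-+ (suc m) n = trans (cong (1# +_) (fromℕ-+ m n)) (sym (+-assoc 1# (fromℕ m) (fromℕ n)))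

  fromℕ-nonneg : ∀ n → 0# ≤ fromℕ n
  fromℕ-nonneg zero    = ≤-refl 0#
  fromℕ-nonneg (suc n) = ≤-trans 0≤1 (x≤x+y (fromℕ-nonneg n))

  fromℕ-pos : ∀ {n} → 0 N.< n → 0# < fromℕ n
  fromℕ-pos {suc n} _ = +-pos-nonneg 0<1 (fromℕ-nonneg n)

  fromℕ-mono : ∀ {m n} → m N.≤ n → fromℕ m ≤ fromℕ n
  fromℕ-mono {m} {n} m≤n = subst (fromℕ m ≤_)
    (trans (sym (fromℕ-+ m (n N.∸ m))) (cong fromℕ (NP.m+[n∸m]≡n m≤n)))
    (x≤x+y (fromℕ-nonneg (n N.∸ m)))

  Σ-cong : ∀ {k} {f g : Fin k → Carrier} → (∀ i → f i ≡ g i) → Σ[ f ] ≡ Σ[ g ]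
  Σ-cong {zero}  f≗g = refl
  Σ-cong {suc k} f≗g = cong₂ _+_ (f≗g Fin.zero) (Σ-cong (f≗g ∘ Fin.suc))

  Σ-zero : ∀ {k} → Σ[ (λ (_ : Fin k) → 0#) ] ≡ 0#
  Σ-zero {zero}  = refl
  Σ-zero {suc k} = trans (+-identityˡ _) (Σ-zero {k})

  Σ-+ : ∀ {k} (f g : Fin k → Carrier) → Σ[ (λ i → f i + g i) ] ≡ Σ[ f ] + Σ[ g ]
  Σ-+ {zero}  f g = sym (+-identityˡ 0#)
  Σ-+ {suc k} f g = trans (cong (f Fin.zero + g Fin.zero +_) (Σ-+ (f ∘ Fin.suc) (g ∘ Fin.suc)))
    (solve 4 (λ a b c e → (a :+ b) :+ (c :+ e) := (a :+ c) :+ (b :+ e)) refl _ _ _ _)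

  Σ-*ˡ : ∀ {k} c (f : Fin k → Carrier) → Σ[ (λ i → c * f i) ] ≡ c * Σ[ f ]
  Σ-*ˡ {zero}  c f = sym (zeroʳ c)
  Σ-*ˡ {suc k} c f = trans (cong (c * f Fin.zero +_) (Σ-*ˡ c (f ∘ Fin.suc)))
    (sym (distribˡ c (f Fin.zero) _))

  Σ-neg : ∀ {k} (f : Fin k → Carrier) → Σ[ (λ i → - f i) ] ≡ - Σ[ f ]
  Σ-neg {zero}  f = sym ε⁻¹≈ε
  Σ-neg {suc k} f = trans (cong (- f Fin.zero +_) (Σ-neg (f ∘ Fin.suc))) (⁻¹-∙-comm _ _)

  Σ-mono-≤ : ∀ {k} {f g : Fin k → Carrier} → (∀ i → f i ≤ g i) → Σ[ f ] ≤ Σ[ g ]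
  Σ-mono-≤ {zero}  f≤g = ≤-refl 0#
  Σ-mono-≤ {suc k} f≤g = +-mono-≤ (f≤g Fin.zero) (Σ-mono-≤ (f≤g ∘ Fin.suc))

  Σ-nonneg : ∀ {k} {f : Fin k → Carrier} → (∀ i → 0# ≤ f i) → 0# ≤ Σ[ f ]
  Σ-nonneg {k} {f} 0≤f = subst (_≤ Σ[ f ]) (Σ-zero {k}) (Σ-mono-≤ 0≤f)

  ≤-Σ : ∀ {k} {f : Fin k → Carrier} → (∀ i → 0# ≤ f i) → ∀ j → f j ≤ Σ[ f ]
  ≤-Σ {suc k} 0≤f Fin.zero    = x≤x+y (Σ-nonneg (0≤f ∘ Fin.suc))
  ≤-Σ {suc k} {f} 0≤f (Fin.suc j) = ≤-trans (≤-Σ (0≤f ∘ Fin.suc) j)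
    (subst (_≤ Σ[ f ]) (+-identityˡ _) (+-monoˡ-≤ Σ[ f ∘ Fin.suc ] (0≤f Fin.zero)))

  Σ² : ∀ {k l} → (Fin k → Fin l → Carrier) → Carrier
  Σ² f = Σ[ (λ i → Σ[ f i ]) ]

  Σ²-cong : ∀ {k l} {f g : Fin k → Fin l → Carrier} → (∀ i j → f i j ≡ g i j) → Σ² f ≡ Σ² g
  Σ²-cong f≗g = Σ-cong (Σ-cong ∘ f≗g)

  Σ²-+ : ∀ {k l} (f g : Fin k → Fin l → Carrier) →
         Σ² (λ i j → f i j + g i j) ≡ Σ² f + Σ² g
  Σ²-+ f g = trans (Σ-cong (λ i → Σ-+ (f i) (g i))) (Σ-+ (λ i → Σ[ f i ]) (λ i → Σ[ g i ]))

  Σ²-*ˡ : ∀ {k l} c (f : Fin k → Fin l → Carrier) → Σ² (λ i j → c * f i j) ≡ c * Σ² f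
  Σ²-*ˡ c f = trans (Σ-cong (λ i → Σ-*ˡ c (f i))) (Σ-*ˡ c (λ i → Σ[ f i ]))

  Σ²-mono-≤ : ∀ {k l} {f g : Fin k → Fin l → Carrier} → (∀ i j → f i j ≤ g i j) → Σ² f ≤ Σ² g
  Σ²-mono-≤ f≤g = Σ-mono-≤ (Σ-mono-≤ ∘ f≤g)

  Σ²-nonneg : ∀ {k l} {f : Fin k → Fin l → Carrier} → (∀ i j → 0# ≤ f i j) → 0# ≤ Σ² f
  Σ²-nonneg 0≤f = Σ-nonneg (Σ-nonneg ∘ 0≤f)

  Σ²-transpose : ∀ {k l} (f : Fin k → Fin l → Carrier) → Σ² f ≡ Σ² (λ j i → f i j)
  Σ²-transpose {zero}  {l} f = sym (Σ-zero {l})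
  Σ²-transpose {suc k}     f = trans (cong (Σ[ f Fin.zero ] +_) (Σ²-transpose (f ∘ Fin.suc)))
    (sym (Σ-+ (f Fin.zero) (λ j → Σ[ (λ i → f (Fin.suc i) j) ])))

  𝟙 : Bool → Carrier
  𝟙 b = if b then 1# else 0#

  𝟙-∨ : ∀ a b → 𝟙 (a ∨ b) ≤ 𝟙 a + 𝟙 b
  𝟙-∨ true  true  = x≤x+y 0≤1
  𝟙-∨ true  false = x≤x+y (≤-refl 0#)
  𝟙-∨ false true  = ≤-reflexive (sym (+-identityˡ 1#))
  𝟙-∨ false false = ≤-reflexive (sym (+-identityˡ 0#))

  χ-∈ : ∀ {n} {S : Subset n} {x} → x ∈ S → χ S x ≡ 1#
  χ-∈ x∈S = cong 𝟙 ([]=⇒lookup x∈S)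

  χ-∉ : ∀ {n} {S : Subset n} {x} → x ∉ S → χ S x ≡ 0#
  χ-∉ {S = S} {x} x∉S with lookup S x in eq
  ... | true  = ⊥-elim (x∉S (lookup⇒[]= x S eq))
  ... | false = refl

  χ-nonneg : ∀ {n} (S : Subset n) x → 0# ≤ χ S x
  χ-nonneg S x with x ∈? S
  ... | yes x∈S = subst (0# ≤_) (sym (χ-∈ x∈S)) 0≤1
  ... | no  x∉S = ≤-reflexive (sym (χ-∉ x∉S))

  χ-mono : ∀ {n} {S T : Subset n} → S ⊆ T → ∀ x → χ S x ≤ χ T x
  χ-mono {S = S} {T} S⊆T x with x ∈? S
  ... | yes x∈S = ≤-reflexive (trans (χ-∈ x∈S) (sym (χ-∈ (S⊆T x∈S))))
  ... | no  x∉S = subst (_≤ χ T x) (sym (χ-∉ x∉S)) (χ-nonneg T x)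

  χ-∪ : ∀ {n} (S T : Subset n) x → χ (S ∪ T) x ≤ χ S x + χ T x
  χ-∪ S T x = subst (_≤ χ S x + χ T x) (cong 𝟙 (sym (lookup-zipWith _∨_ x S T)))
    (𝟙-∨ (lookup S x) (lookup T x))

  Σ-χ : ∀ {n} (S : Subset n) → Σ[ χ S ] ≡ fromℕ ∣ S ∣
  Σ-χ []          = refl
  Σ-χ (true ∷ S)  = cong (1# +_) (Σ-χ S)
  Σ-χ (false ∷ S) = trans (+-identityˡ _) (Σ-χ S)

  p≢⊥⇒0<∣p∣ : ∀ {n} {S : Subset n} → S ≢ ⊥ → 0 N.< ∣ S ∣
  p≢⊥⇒0<∣p∣ {S = S} S≢⊥ with nonempty? S
  ... | yes (x , x∈S) = NP.≤-<-trans N.z≤n (x∈p⇒∣p-x∣<∣p∣ x∈S)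
  ... | no  S-empty   = ⊥-elim (S≢⊥ (Empty-unique S-empty))

  ⊆-∪⇒⊆-∩-∪-∩ : ∀ {n} {S T U : Subset n} → S ⊆ T ∪ U → S ⊆ (S ∩ T) ∪ (S ∩ U)
  ⊆-∪⇒⊆-∩-∪-∩ {S = S} {T} {U} S⊆T∪U x∈S = x∈p∪q⁺
    ([ (λ x∈T → inj₁ (x∈p∩q⁺ (x∈S , x∈T))) , (λ x∈U → inj₂ (x∈p∩q⁺ (x∈S , x∈U))) ]′
      (x∈p∪q⁻ T U (S⊆T∪U x∈S)))

  fromℕ-∣∣-⊆-∪ : ∀ {n} {S : Subset n} T U → S ⊆ T ∪ U → fromℕ ∣ S ∣ ≤ fromℕ ∣ T ∣ + fromℕ ∣ U ∣
  fromℕ-∣∣-⊆-∪ {S = S} T U S⊆T∪U = begin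
    fromℕ ∣ S ∣                 ≡⟨ sym (Σ-χ S) ⟩
    Σ[ χ S ]                    ≤⟨ Σ-mono-≤ (λ x → ≤-trans (χ-mono S⊆T∪U x) (χ-∪ T U x)) ⟩
    Σ[ (λ x → χ T x + χ U x) ]  ≡⟨ Σ-+ (χ T) (χ U) ⟩
    Σ[ χ T ] + Σ[ χ U ]         ≡⟨ cong₂ _+_ (Σ-χ T) (Σ-χ U) ⟩
    fromℕ ∣ T ∣ + fromℕ ∣ U ∣   ∎
    where open ≤-Reasoning

module NegativeTypeBounds (R : CompleteOrderedField) where
  open CompleteOrderedField R
  open OverReals R
  open OrderedFieldProperties R

  module _ {n} (d : Fin n → Fin n → Carrier) where

    bilinear : (Fin n → Carrier) → (Fin n → Carrier) → Carrier
    bilinear u v = Σ² (λ a b → u a * d a b * v b)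

    bilinear-+ˡ : ∀ u w v → bilinear (λ a → u a + w a) v ≡ bilinear u v + bilinear w v
    bilinear-+ˡ u w v = trans
      (Σ²-cong (λ a b → solve 4 (λ x y e z → (x :+ y) :* e :* z := x :* e :* z :+ y :* e :* z)
                          refl (u a) (w a) (d a b) (v b)))
      (Σ²-+ (λ a b → u a * d a b * v b) (λ a b → w a * d a b * v b))

    bilinear-*ˡ : ∀ c u v → bilinear (λ a → c * u a) v ≡ c * bilinear u v
    bilinear-*ˡ c u v = trans
      (Σ²-cong (λ a b → solve 4 (λ c x e z → c :* x :* e :* z := c :* (x :* e :* z))
                          refl c (u a) (d a b) (v b)))
      (Σ²-*ˡ c (λ a b → u a * d a b * v b))

    bilinear-*ʳ : ∀ c u v → bilinear u (λ b → c * v b) ≡ c * bilinear u v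
    bilinear-*ʳ c u v = trans
      (Σ²-cong (λ a b → solve 4 (λ c x e z → x :* e :* (c :* z) := c :* (x :* e :* z))
                          refl c (u a) (d a b) (v b)))
      (Σ²-*ˡ c (λ a b → u a * d a b * v b))

    bilinear-zeroˡ : ∀ v → bilinear (λ _ → 0#) v ≡ 0#
    bilinear-zeroˡ v = trans
      (Σ²-cong (λ a b → trans (cong (_* v b) (zeroˡ (d a b))) (zeroˡ (v b))))
      (trans (Σ-cong {n} (λ _ → Σ-zero {n})) (Σ-zero {n}))

    bilinear-Σˡ : ∀ {m} (c : Fin m → Carrier) (u : Fin m → Fin n → Carrier) v →
      bilinear (λ a → Σ[ (λ i → c i * u i a) ]) v ≡ Σ[ (λ i → c i * bilinear (u i) v) ]
    bilinear-Σˡ {zero}  c u v = bilinear-zeroˡ v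
    bilinear-Σˡ {suc m} c u v = trans (bilinear-+ˡ _ _ v)
      (cong₂ _+_ (bilinear-*ˡ (c Fin.zero) (u Fin.zero) v)
                 (bilinear-Σˡ (c ∘ Fin.suc) (u ∘ Fin.suc) v))

    bilinear-monoˡ : (∀ a b → 0# ≤ d a b) → ∀ {u u′ v} → (∀ b → 0# ≤ v b) →
      (∀ a → u a ≤ u′ a) → bilinear u v ≤ bilinear u′ v
    bilinear-monoˡ 0≤d {v = v} 0≤v u≤u′ =
      Σ²-mono-≤ (λ a b → *-monoʳ-≤ (0≤v b) (*-monoʳ-≤ (0≤d a b) (u≤u′ a)))

    bilinear-comm : (∀ a b → d a b ≡ d b a) → ∀ u v → bilinear u v ≡ bilinear v u
    bilinear-comm d-sym u v = trans (Σ²-transpose (λ a b → u a * d a b * v b))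
      (Σ²-cong (λ b a → trans (cong (λ e → u a * e * v b) (d-sym a b))
        (solve 3 (λ x e z → x :* e :* z := z :* e :* x) refl (u a) (d b a) (v b))))

    -- Expanding (u - v)ᵀ D (u - v) ≤ 0.
    negativeType⇒polarisation : NegativeType d → ∀ u v → Σ[ u ] ≡ Σ[ v ] →
      bilinear u u + bilinear v v ≤ bilinear u v + bilinear v u
    negativeType⇒polarisation negType u v Σu≡Σv =
      subst (_≤ bilinear u v + bilinear v u) expansion (x≤0⇒x+y≤y (negType w Σw≡0))
      where
        w : Fin n → Carrier
        w a = u a + - v a

        Σw≡0 : Σ[ w ] ≡ 0#
        Σw≡0 = trans (Σ-+ u (λ a → - v a))
          (trans (cong (Σ[ u ] +_) (Σ-neg v)) (x≈y⇒x∙y⁻¹≈ε Σu≡Σv))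

        -- u = w + v turns the expansion into a semiring identity in w and v.
        pointwise : ∀ a b → w a * d a b * w b + (u a * d a b * v b + v a * d a b * u b)
                          ≡ u a * d a b * u b + v a * d a b * v b
        pointwise a b = subst₂
          (λ ua ub → w a * d a b * w b + (ua * d a b * v b + v a * d a b * ub)
                   ≡ ua * d a b * ub + v a * d a b * v b)
          (//-rightDividesˡ (v a) (u a)) (//-rightDividesˡ (v b) (u b))
          (solve 5 (λ wa va e wb vb →
              wa :* e :* wb :+ ((wa :+ va) :* e :* vb :+ va :* e :* (wb :+ vb))
            := (wa :+ va) :* e :* (wb :+ vb) :+ va :* e :* vb)
            refl (w a) (v a) (d a b) (w b) (v b))

        expansion : bilinear w w + (bilinear u v + bilinear v u) ≡ bilinear u u + bilinear v v
        expansion = begin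
          bilinear w w + (bilinear u v + bilinear v u)
            ≡⟨ cong (bilinear w w +_) (sym (Σ²-+ (λ a b → u a * d a b * v b) (λ a b → v a * d a b * u b))) ⟩
          bilinear w w + Σ² (λ a b → u a * d a b * v b + v a * d a b * u b)
            ≡⟨ sym (Σ²-+ (λ a b → w a * d a b * w b) _) ⟩
          Σ² (λ a b → w a * d a b * w b + (u a * d a b * v b + v a * d a b * u b))
            ≡⟨ Σ²-cong pointwise ⟩
          Σ² (λ a b → u a * d a b * u b + v a * d a b * v b)
            ≡⟨ Σ²-+ (λ a b → u a * d a b * u b) (λ a b → v a * d a b * v b) ⟩
          bilinear u u + bilinear v v ∎
          where open ≡-Reasoning

  dPair≡bilinear : ∀ {n} (d : Fin n → Fin n → Carrier) S T → dPair d S T ≡ bilinear d (χ S) (χ T)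
  dPair≡bilinear d S T = Σ²-cong (λ a b →
    solve 3 (λ x y e → x :* y :* e := x :* e :* y) refl (χ S a) (χ T b) (d a b))

  bilinear-scaled-χ : ∀ {n} (d : Fin n → Fin n → Carrier) c e S T →
    bilinear d (λ a → c * χ S a) (λ b → e * χ T b) ≡ (c * e) * dPair d S T
  bilinear-scaled-χ d c e S T = begin
    bilinear d (λ a → c * χ S a) (λ b → e * χ T b) ≡⟨ bilinear-*ˡ d c (χ S) _ ⟩
    c * bilinear d (χ S) (λ b → e * χ T b)         ≡⟨ cong (c *_) (bilinear-*ʳ d e (χ S) (χ T)) ⟩
    c * (e * bilinear d (χ S) (χ T))               ≡⟨ sym (*-assoc c e _) ⟩
    (c * e) * bilinear d (χ S) (χ T)               ≡⟨ cong ((c * e) *_) (sym (dPair≡bilinear d S T)) ⟩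
    (c * e) * dPair d S T                          ∎
    where open ≡-Reasoning

  ∉-of-Σ≡0 : ∀ {n m} {P : Fin m → Subset n} {λ' : Fin m → Carrier} {x} → (∀ i → 0# < λ' i) →
    Σ[ (λ i → λ' i * χ (P i) x) ] ≡ 0# → ∀ i → x ∉ P i
  ∉-of-Σ≡0 {P = P} {λ'} {x} 0<λ Σ≡0 i x∈Pᵢ = proj₂ (0<λ i) (≤-antisym (proj₁ (0<λ i)) λᵢ≤0)
    where
      open ≤-Reasoning
      λᵢ≤0 : λ' i ≤ 0#
      λᵢ≤0 = begin
        λ' i                           ≡⟨ sym (trans (cong (λ' i *_) (χ-∈ x∈Pᵢ)) (*-identityʳ (λ' i))) ⟩
        λ' i * χ (P i) x               ≤⟨ ≤-Σ (λ j → *-nonneg (proj₁ (0<λ j)) (χ-nonneg (P j) x)) i ⟩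
        Σ[ (λ j → λ' j * χ (P j) x) ]  ≡⟨ Σ≡0 ⟩
        0#                             ∎

  decomposition⇒⊆-∪ : ∀ {n m} {A B : Subset n} {P : Fin m → Subset n} {λ' : Fin m → Carrier} {q} →
    (∀ i → 0# < λ' i) →
    (∀ x → Σ[ (λ i → λ' i * χ (P i) x) ] ≡ q * χ (A ─ B) x + χ (B ─ A) x) →
    ∀ i → P i ⊆ A ∪ B
  decomposition⇒⊆-∪ {A = A} {B} {P} {q = q} 0<λ decomposition i {x} x∈Pᵢ with x ∈? A ∪ B
  ... | yes x∈A∪B = x∈A∪B
  ... | no  x∉A∪B = ⊥-elim (∉-of-Σ≡0 {P = P} 0<λ (trans (decomposition x) rhs≡0) i x∈Pᵢ)
    where
      rhs≡0 : q * χ (A ─ B) x + χ (B ─ A) x ≡ 0#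
      rhs≡0 = trans
        (cong₂ (λ s t → q * s + t) (χ-∉ (x∉A∪B ∘ p⊆p∪q B ∘ p─q⊆p A B))
                                   (χ-∉ (x∉A∪B ∘ q⊆p∪q A B ∘ p─q⊆p B A)))
        (trans (+-identityʳ (q * 0#)) (zeroʳ q))

  module _ {n} {d : Fin n → Fin n → Carrier} (isDistance : IsDistance d) where
    open IsDistance isDistance renaming (sym to d-sym)

    dPair-nonneg : ∀ S T → 0# ≤ dPair d S T
    dPair-nonneg S T =
      Σ²-nonneg (λ a b → *-nonneg (*-nonneg (χ-nonneg S a) (χ-nonneg T b)) (nonneg a b))

    dPair-comm : ∀ S T → dPair d S T ≡ dPair d T S
    dPair-comm S T = trans (dPair≡bilinear d S T)
      (trans (bilinear-comm d d-sym (χ S) (χ T)) (sym (dPair≡bilinear d T S)))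

    private
      upper : Subset n → Fin n → Fin n → Carrier
      upper S a b = if toℕ a N.<ᵇ toℕ b then χ S a * χ S b * d a b else 0#

      pair≡upper+upper : ∀ S a b → χ S a * χ S b * d a b ≡ upper S a b + upper S b a
      pair≡upper+upper S a b
        with toℕ a N.<ᵇ toℕ b | NP.<ᵇ-reflects-< (toℕ a) (toℕ b)
           | toℕ b N.<ᵇ toℕ a | NP.<ᵇ-reflects-< (toℕ b) (toℕ a)
      ... | true  | ofʸ a<b | true  | ofʸ b<a = ⊥-elim (NP.<-asym a<b b<a)
      ... | true  | _       | false | _       = sym (+-identityʳ _)
      ... | false | _       | true  | _       = trans
        (trans (cong (χ S a * χ S b *_) (d-sym a b))
               (solve 3 (λ x y e → x :* y :* e := y :* x :* e) refl (χ S a) (χ S b) (d b a)))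
        (sym (+-identityˡ _))
      ... | false | ofⁿ a≮b | false | ofⁿ b≮a = trans
        (cong (χ S a * χ S b *_) (trans (cong (d a) (sym a≡b)) (refl0 a)))
        (trans (zeroʳ _) (sym (+-identityˡ 0#)))
        where
          a≡b : a ≡ b
          a≡b = FP.toℕ-injective (NP.≤-antisym (NP.≮⇒≥ b≮a) (NP.≮⇒≥ a≮b))

    dPair-diag : ∀ S → dPair d S S ≡ dSet d S + dSet d S
    dPair-diag S = begin
      dPair d S S                                   ≡⟨ Σ²-cong (pair≡upper+upper S) ⟩
      Σ² (λ a b → upper S a b + upper S b a)        ≡⟨ Σ²-+ (upper S) (λ a b → upper S b a) ⟩
      dSet d S + Σ² (λ a b → upper S b a)           ≡⟨ cong (dSet d S +_) (sym (Σ²-transpose (upper S))) ⟩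
      dSet d S + dSet d S                           ∎
      where open ≡-Reasoning

    -- Polarisation at u = |A| χ_P and v = |P| χ_A, which have the same total mass |A| |P|.
    ∣A∣dSet≤∣P∣dPair : NegativeType d → ∀ {A} P → 0# < fromℕ ∣ A ∣ →
      fromℕ ∣ A ∣ * dSet d P ≤ fromℕ ∣ P ∣ * dPair d P A
    ∣A∣dSet≤∣P∣dPair negType {A} P 0<α = *-cancelˡ-≤ 0<α+α (begin
      (α + α) * (α * dSet d P)
        ≡⟨ solve 2 (λ a s → (a :+ a) :* (a :* s) := (a :* a) :* (s :+ s)) refl α (dSet d P) ⟩
      (α * α) * (dSet d P + dSet d P)                   ≡⟨ cong ((α * α) *_) (sym (dPair-diag P)) ⟩
      (α * α) * dPair d P P                             ≤⟨ x≤x+y (*-nonneg (*-nonneg 0≤β 0≤β) (dPair-nonneg A A)) ⟩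
      (α * α) * dPair d P P + (β * β) * dPair d A A     ≡⟨ sym (cong₂ _+_ (bilinear-scaled-χ d α α P P) (bilinear-scaled-χ d β β A A)) ⟩
      bilinear d u u + bilinear d v v                   ≤⟨ negativeType⇒polarisation d negType u v Σu≡Σv ⟩
      bilinear d u v + bilinear d v u                   ≡⟨ cong₂ _+_ (bilinear-scaled-χ d α β P A) (bilinear-scaled-χ d β α A P) ⟩
      (α * β) * dPair d P A + (β * α) * dPair d A P     ≡⟨ cong ((α * β) * dPair d P A +_) (cong ((β * α) *_) (dPair-comm A P)) ⟩
      (α * β) * dPair d P A + (β * α) * dPair d P A
        ≡⟨ solve 3 (λ a b x → a :* b :* x :+ b :* a :* x := (a :+ a) :* (b :* x)) refl α β (dPair d P A) ⟩
      (α + α) * (β * dPair d P A)                       ∎)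
      where
        open ≤-Reasoning
        α β : Carrier
        α = fromℕ ∣ A ∣
        β = fromℕ ∣ P ∣
        0≤β : 0# ≤ β
        0≤β = fromℕ-nonneg ∣ P ∣
        0<α+α : 0# < (α + α)
        0<α+α = +-pos-nonneg 0<α (proj₁ 0<α)
        u v : Fin n → Carrier
        u a = α * χ P a
        v a = β * χ A a
        Σu≡Σv : Σ[ u ] ≡ Σ[ v ]
        Σu≡Σv = begin-equality
          Σ[ u ]     ≡⟨ trans (Σ-*ˡ α (χ P)) (cong (α *_) (Σ-χ P)) ⟩
          α * β      ≡⟨ *-comm α β ⟩
          β * α      ≡⟨ sym (trans (Σ-*ˡ β (χ A)) (cong (β *_) (Σ-χ A))) ⟩
          Σ[ v ]     ∎

    Σ-dPair-decomposition-≤ : ∀ {A B m} (P : Fin m → Subset n) (λ' : Fin m → Carrier) {q} → 0# ≤ q →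
      (∀ x → Σ[ (λ i → λ' i * χ (P i) x) ] ≡ q * χ (A ─ B) x + χ (B ─ A) x) →
      Σ[ (λ i → λ' i * dPair d (P i) A) ] ≤ q * dPair d A A + dPair d A B
    Σ-dPair-decomposition-≤ {A} {B} P λ' {q} 0≤q decomposition = begin
      Σ[ (λ i → λ' i * dPair d (P i) A) ]
        ≡⟨ Σ-cong (λ i → cong (λ' i *_) (dPair≡bilinear d (P i) A)) ⟩
      Σ[ (λ i → λ' i * bilinear d (χ (P i)) (χ A)) ]
        ≡⟨ sym (bilinear-Σˡ d λ' (χ ∘ P) (χ A)) ⟩
      bilinear d (λ x → Σ[ (λ i → λ' i * χ (P i) x) ]) (χ A)
        ≡⟨ Σ²-cong (λ x b → cong (λ t → t * d x b * χ A b) (decomposition x)) ⟩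
      bilinear d (λ x → q * χ (A ─ B) x + χ (B ─ A) x) (χ A)
        ≤⟨ bilinear-monoˡ d nonneg (χ-nonneg A) (λ x →
             +-mono-≤ (*-monoˡ-≤ 0≤q (χ-mono (p─q⊆p A B) x)) (χ-mono (p─q⊆p B A) x)) ⟩
      bilinear d (λ x → q * χ A x + χ B x) (χ A)
        ≡⟨ bilinear-+ˡ d (λ x → q * χ A x) (χ B) (χ A) ⟩
      bilinear d (λ x → q * χ A x) (χ A) + bilinear d (χ B) (χ A)
        ≡⟨ cong₂ _+_ (bilinear-*ˡ d q (χ A) (χ A)) (sym (dPair≡bilinear d B A)) ⟩
      q * bilinear d (χ A) (χ A) + dPair d B A
        ≡⟨ cong₂ (λ s t → q * s + t) (sym (dPair≡bilinear d A A)) (dPair-comm B A) ⟩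
      q * dPair d A A + dPair d A B
        ∎
      where open ≤-Reasoning

    weighted-dSet-≤ : NegativeType d → ∀ {A B m} (P : Fin m → Subset n) (λ' : Fin m → Carrier) {q k} →
      0# < fromℕ ∣ A ∣ → 0# < k → 0# ≤ q → (∀ i → 0# ≤ λ' i) → (∀ i → fromℕ ∣ P i ∣ ≤ k) →
      (∀ x → Σ[ (λ i → λ' i * χ (P i) x) ] ≡ q * χ (A ─ B) x + χ (B ─ A) x) →
      (fromℕ ∣ A ∣ / k) * Σ[ (λ i → λ' i * dSet d (P i)) ] ≤ q * dPair d A A + dPair d A B
    weighted-dSet-≤ negType {A} {B} P λ' {q} {k} 0<α 0<k 0≤q 0≤λ ∣P∣≤k decomposition = begin
      c * Σ[ (λ i → λ' i * dSet d (P i)) ]      ≡⟨ sym (Σ-*ˡ c (λ i → λ' i * dSet d (P i))) ⟩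
      Σ[ (λ i → c * (λ' i * dSet d (P i))) ]    ≡⟨ Σ-cong (λ i → solve 3 (λ c l s → c :* (l :* s) := l :* (c :* s)) refl c (λ' i) (dSet d (P i))) ⟩
      Σ[ (λ i → λ' i * (c * dSet d (P i))) ]    ≤⟨ Σ-mono-≤ (λ i → *-monoˡ-≤ (0≤λ i) (c·dSet≤dPair i)) ⟩
      Σ[ (λ i → λ' i * dPair d (P i) A) ]       ≤⟨ Σ-dPair-decomposition-≤ {A} {B} P λ' 0≤q decomposition ⟩
      q * dPair d A A + dPair d A B             ∎
      where
        open ≤-Reasoning
        c : Carrier
        c = fromℕ ∣ A ∣ / k
        c·dSet≤dPair : ∀ i → c * dSet d (P i) ≤ dPair d (P i) A
        c·dSet≤dPair i = *-≤-⇒-/-≤ 0<k (≤-trans (∣A∣dSet≤∣P∣dPair negType {A} (P i) 0<α)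
          (*-monoʳ-≤ (dPair-nonneg (P i) A) (∣P∣≤k i)))

p+[p∸1]≡2p∸1 : ∀ p → p N.+ (p N.∸ 1) ≡ 2 N.* p N.∸ 1
p+[p∸1]≡2p∸1 zero    = refl
p+[p∸1]≡2p∸1 (suc r) = sym (trans (cong (r N.+_) (NP.+-identityʳ (suc r))) (NP.+-suc r r))

mainTheorem8 : (R : CompleteOrderedField) → let open CompleteOrderedField R in let open OverReals R in
    {n : ℕ} (d : Fin n → Fin n → Carrier) → IsDistance d → NegativeType d →
    (M₁ M₂ : Matroid n) → (p : ℕ) → 2 N.≤ p →
    (A B : Subset n) →
    Matroid.Indep M₁ A → Matroid.Indep M₂ A →
    Matroid.Indep M₁ B → Matroid.Indep M₂ B →
    A ≢ S.⊥ →
    (m : ℕ) (P : Fin m → Subset n) (λ' : Fin m → Carrier) →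
    (∀ i → S.Nonempty (P i)) →
    (∀ i → 0# < λ' i) →
    (∀ i → S.∣ P i S.∩ A ∣ N.≤ p) →
    (∀ i → S.∣ P i S.∩ B ∣ N.≤ p N.∸ 1) →
    (∀ i → Matroid.Indep M₁ (A Δ P i) × Matroid.Indep M₂ (A Δ P i)) →
    (∀ x → Σ[ (λ i → λ' i * χ (P i) x) ] ≡
           (fromℕ p / fromℕ (p N.∸ 1)) * χ (A S.─ B) x + χ (B S.─ A) x) →
    (fromℕ S.∣ A ∣ / fromℕ (2 N.* p N.∸ 1)) * Σ[ (λ i → λ' i * dSet d (P i)) ]
      ≤ (fromℕ p / fromℕ (p N.∸ 1)) * dPair d A A + dPair d A B
mainTheorem8 R d isDistance negType _ _ p@(suc (suc r)) (N.s≤s (N.s≤s _)) A B _ _ _ _ A≢⊥ m P λ' _ 0<λ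
             ∣P∩A∣≤p ∣P∩B∣≤p∸1 _ decomposition =
  weighted-dSet-≤ isDistance negType {A} {B} P λ'
    (fromℕ-pos (p≢⊥⇒0<∣p∣ A≢⊥)) (fromℕ-pos {2 N.* p N.∸ 1} N.z<s)
    (/-nonneg (fromℕ-nonneg p) (fromℕ-pos {p N.∸ 1} N.z<s)) (proj₁ ∘ 0<λ) ∣P∣≤2p∸1 decomposition
  where
    open CompleteOrderedField R
    open OverReals R
    open OrderedFieldProperties R
    open NegativeTypeBounds R

    ∣P∣≤2p∸1 : ∀ i → fromℕ ∣ P i ∣ ≤ fromℕ (2 N.* p N.∸ 1)
    ∣P∣≤2p∸1 i = begin
      fromℕ ∣ P i ∣                             ≤⟨ fromℕ-∣∣-⊆-∪ (P i ∩ A) (P i ∩ B) (⊆-∪⇒⊆-∩-∪-∩ (decomposition⇒⊆-∪ {A = A} {B} {P} 0<λ decomposition i)) ⟩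
      fromℕ ∣ P i ∩ A ∣ + fromℕ ∣ P i ∩ B ∣     ≤⟨ +-mono-≤ (fromℕ-mono (∣P∩A∣≤p i)) (fromℕ-mono (∣P∩B∣≤p∸1 i)) ⟩
      fromℕ p + fromℕ (p N.∸ 1)                 ≡⟨ sym (fromℕ-+ p (p N.∸ 1)) ⟩
      fromℕ (p N.+ (p N.∸ 1))                   ≡⟨ cong fromℕ (p+[p∸1]≡2p∸1 p) ⟩
      fromℕ (2 N.* p N.∸ 1)                     ∎
      where open ≤-Reasoning
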